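{- Let $X$ be a finite set with $N=|X|\ge 1$ elements, let $s=(s_0,s_1,\ldots,s_{N-1})$ be an $N$-cycle on $X$ and let $\pi$ be an arbitrary permutation of $X$. Let $D=s\circ\pi^{ -1}$. Let $\bar X=\{\bar x: x\in X\}$ be a disjoint copy of $X$ and define permutations $\hat s,\hat\pi$ of $X\cup\bar X$ by $$\hat s=(s_0,\bar s_0,s_1,\bar s_1,\ldots,s_{N-1},\bar s_{N-1}),$$ $\hat\pi(x)=\pi(x)$ for $x\in X$, and $\hat\pi(\bar s_i)=\overline{\pi^{ -1}(s_{i+1})}$ for $0\le i\le N-1$, indices taken modulo $N$. Then $\hat\pi$ maps $\bar X$ to itself, and the restriction $\hat\pi|_{\bar X}$ has the same number of cycles as $D$.
   Context: Permutations are composed right to left: $(\sigma\circ\tau)(x)=\sigma(\tau(x))$. The pair $(s,\pi)$ is called a plane permutation and $D$ its diagonal. -}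

module Defs where

open import Data.Nat using (ℕ; zero; suc)
open import Data.Nat.DivMod using (_%_; m%n<n)
open import Data.Fin using (Fin; toℕ; fromℕ<)
open import Data.Fin.Permutation using (Permutation′; _⟨$⟩ʳ_; _⟨$⟩ˡ_)
open import Data.Sum using (_⊎_; inj₁; inj₂)
open import Data.Product using (Σ; ∃; _×_)
open import Relation.Binary.PropositionalEquality using (_≡_)

sucMod : {n : ℕ} → Fin (suc n) → Fin (suc n)
sucMod {n} i = fromℕ< (m%n<n (suc (toℕ i)) (suc n))

iter : {A : Set} → (A → A) → ℕ → A → A
iter f zero    x = x
iter f (suc k) x = f (iter f k x)

-- The N-cycle s = (s_0, ..., s_{N-1}) on X = Fin N, where the enumeration
-- i ↦ s_i is the bijection σ : Fin N → X:  s(s_i) = s_{i+1}.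
cycleOf : {n : ℕ} → Permutation′ (suc n) → Fin (suc n) → Fin (suc n)
cycleOf σ x = σ ⟨$⟩ʳ sucMod (σ ⟨$⟩ˡ x)

diag : {n : ℕ} → (σ π : Permutation′ (suc n)) → Fin (suc n) → Fin (suc n)
diag σ π x = cycleOf σ (π ⟨$⟩ˡ x)

-- X ∪ X̄ is modelled as Fin N ⊎ Fin N, inj₁ x = x, inj₂ x = x̄.
-- ŝ = (s_0, s̄_0, s_1, s̄_1, ..., s_{N-1}, s̄_{N-1})
sHat : {n : ℕ} → (σ : Permutation′ (suc n)) → Fin (suc n) ⊎ Fin (suc n) → Fin (suc n) ⊎ Fin (suc n)
sHat σ (inj₁ x) = inj₂ x
sHat σ (inj₂ x) = inj₁ (σ ⟨$⟩ʳ sucMod (σ ⟨$⟩ˡ x))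

piHat : {n : ℕ} → (σ π : Permutation′ (suc n)) → Fin (suc n) ⊎ Fin (suc n) → Fin (suc n) ⊎ Fin (suc n)
piHat σ π (inj₁ x) = inj₁ (π ⟨$⟩ʳ x)
piHat σ π (inj₂ x) = inj₂ (π ⟨$⟩ˡ (σ ⟨$⟩ʳ sucMod (σ ⟨$⟩ˡ x)))

MapsBarToBar : {n : ℕ} → (Fin (suc n) ⊎ Fin (suc n) → Fin (suc n) ⊎ Fin (suc n)) → Set
MapsBarToBar {n} f = (x : Fin (suc n)) → ∃ λ (y : Fin (suc n)) → f (inj₂ x) ≡ inj₂ y

-- restriction of f to X̄ (as a map on Fin N); only meaningful when MapsBarToBar f
restrictBar : {n : ℕ} → (Fin (suc n) ⊎ Fin (suc n) → Fin (suc n) ⊎ Fin (suc n)) → Fin (suc n) → Fin (suc n)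
restrictBar f x with f (inj₂ x)
... | inj₁ _ = x
... | inj₂ y = y

InCycle : {m : ℕ} → (Fin m → Fin m) → Fin m → Fin m → Set
InCycle f x y = ∃ λ (k : ℕ) → iter f k x ≡ y

HasCycles : {m : ℕ} → (Fin m → Fin m) → ℕ → Set
HasCycles {m} f c =
  Σ (Fin c → Fin m) λ r → (x : Fin m) →
    ∃ λ (i : Fin c) → InCycle f (r i) x × ((j : Fin c) → InCycle f (r j) x → j ≡ i)

-- The restriction of π̂ to the barred copy X̄ is the map  x̄ ↦ bar(π⁻¹(s x)),
-- i.e. π̂|X̄ = π⁻¹ ∘ s  (read through the identification x ↦ x̄).  The diagonal
-- is D = s ∘ π⁻¹, and  π⁻¹ ∘ s = π⁻¹ ∘ D ∘ π,  so π̂|X̄ and D are conjugate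
-- by the bijection π.  Conjugate maps have the same cycle structure, hence
-- the same number of cycles.
module Submission where

open import Defs
open import Data.Nat using (ℕ; suc; zero)
open import Data.Fin using (Fin)
open import Data.Fin.Permutation using (Permutation′; _⟨$⟩ʳ_; _⟨$⟩ˡ_; inverseˡ; inverseʳ)
open import Data.Product using (_×_; _,_)
open import Function.Bundles using (_⇔_; mk⇔)
open import Relation.Binary.PropositionalEquality
open ≡-Reasoning

record Conjugacy {m : ℕ} (f g : Fin m → Fin m) : Set where
  field
    to         : Fin m → Fin m
    from       : Fin m → Fin m
    from∘to    : ∀ x → from (to x) ≡ x
    to∘from    : ∀ y → to (from y) ≡ y
    intertwine : ∀ x → g x ≡ from (f (to x))

conjugacy-sym : {m : ℕ} {f g : Fin m → Fin m} → Conjugacy f g → Conjugacy g f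
conjugacy-sym {f = f} {g} C = record
  { to         = from
  ; from       = to
  ; from∘to    = to∘from
  ; to∘from    = from∘to
  ; intertwine = λ y → sym (begin
      to (g (from y))             ≡⟨ cong to (intertwine (from y)) ⟩
      to (from (f (to (from y)))) ≡⟨ to∘from _ ⟩
      f (to (from y))             ≡⟨ cong f (to∘from y) ⟩
      f y                         ∎)
  }
  where open Conjugacy C

module _ {m : ℕ} {f g : Fin m → Fin m} (C : Conjugacy f g) where
  open Conjugacy C

  iter-conjugate : ∀ k x → iter g k x ≡ from (iter f k (to x))
  iter-conjugate zero    x = sym (from∘to x)
  iter-conjugate (suc k) x = begin
    g (iter g k x)                         ≡⟨ intertwine _ ⟩
    from (f (to (iter g k x)))             ≡⟨ cong (λ z → from (f (to z))) (iter-conjugate k x) ⟩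
    from (f (to (from (iter f k (to x))))) ≡⟨ cong (λ z → from (f z)) (to∘from _) ⟩
    from (f (iter f k (to x)))             ∎

  inCycle-from : ∀ y x → InCycle f y (to x) → InCycle g (from y) x
  inCycle-from y x (k , fᵏy≡tox) = k , (begin
    iter g k (from y)             ≡⟨ iter-conjugate k (from y) ⟩
    from (iter f k (to (from y))) ≡⟨ cong (λ z → from (iter f k z)) (to∘from y) ⟩
    from (iter f k y)             ≡⟨ cong from fᵏy≡tox ⟩
    from (to x)                   ≡⟨ from∘to x ⟩
    x                             ∎)

  inCycle-to : ∀ y x → InCycle g (from y) x → InCycle f y (to x)
  inCycle-to y x (k , gᵏy≡x) = k , (begin
    iter f k y                         ≡⟨ cong (iter f k) (sym (to∘from y)) ⟩
    iter f k (to (from y))             ≡⟨ sym (to∘from _) ⟩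
    to (from (iter f k (to (from y)))) ≡⟨ cong to (sym (iter-conjugate k (from y))) ⟩
    to (iter g k (from y))             ≡⟨ cong to gᵏy≡x ⟩
    to x                               ∎)

  conjugacy-preserves-cycles : ∀ c → HasCycles f c → HasCycles g c
  conjugacy-preserves-cycles c (r , unique-rep) = (λ i → from (r i)) , λ x →
    let (i , rᵢ~tox , only-i) = unique-rep (to x) in
    i , inCycle-from (r i) x rᵢ~tox
      , λ j rⱼ~x → only-i j (inCycle-to (r j) x rⱼ~x)

conjugate-same-cycles : {m : ℕ} {f g : Fin m → Fin m} → Conjugacy f g →
  ∀ c → HasCycles g c ⇔ HasCycles f c
conjugate-same-cycles C c = mk⇔
  (conjugacy-preserves-cycles (conjugacy-sym C) c)
  (conjugacy-preserves-cycles C c)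

piHat-maps-bar-to-bar : {n : ℕ} (σ π : Permutation′ (suc n)) → MapsBarToBar (piHat σ π)
piHat-maps-bar-to-bar σ π x = π ⟨$⟩ˡ cycleOf σ x , refl

-- On X̄, π̂ acts as π⁻¹ ∘ s, which is π⁻¹ ∘ D ∘ π since D = s ∘ π⁻¹.
restricted-piHat-conjugate-to-diag : {n : ℕ} (σ π : Permutation′ (suc n)) →
  Conjugacy (diag σ π) (restrictBar (piHat σ π))
restricted-piHat-conjugate-to-diag σ π = record
  { to         = π ⟨$⟩ʳ_
  ; from       = π ⟨$⟩ˡ_
  ; from∘to    = λ _ → inverseˡ π
  ; to∘from    = λ _ → inverseʳ π
  ; intertwine = λ x → cong (λ z → π ⟨$⟩ˡ cycleOf σ z) (sym (inverseˡ π))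
  }

mainTheorem1 : (n : ℕ) → (σ π : Permutation′ (suc n)) →
    MapsBarToBar (piHat σ π) ×
    ((c : ℕ) → HasCycles (restrictBar (piHat σ π)) c ⇔ HasCycles (diag σ π) c)
mainTheorem1 n σ π =
    piHat-maps-bar-to-bar σ π
  , conjugate-same-cycles (restricted-piHat-conjugate-to-diag σ π)
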